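{- For all positive integers $\ell$ and $n$, $$\mathrm{IR}(K_{1,\ell}, K_{1,n}) = n+\ell.$$
   Context: All graphs are finite and simple. For graphs $F$, $H$, $G$ we write $F \xrightarrow{\text{ind}} (H,G)$ if for every coloring of the edges of $F$ with red and blue, there is either an induced subgraph of $F$ isomorphic to $H$ all of whose edges are red, or an induced subgraph of $F$ isomorphic to $G$ all of whose edges are blue. The induced Ramsey number $\mathrm{IR}(H,G)$ is the smallest number of vertices of a graph $F$ with $F \xrightarrow{\text{ind}} (H,G)$. $K_{1,m}$ denotes the star with $m$ edges. -}

module Defs where

open import Data.Nat using (ℕ; suc; _<_; _+_)
open import Data.Fin using (Fin; zero; suc)
open import Data.Bool using (Bool; true; false)
open import Data.Product using (Σ; ∃; _×_; _,_)
open import Data.Sum using (_⊎_)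
open import Relation.Binary.PropositionalEquality using (_≡_; refl)
open import Relation.Nullary using (¬_)
open import Function.Definitions using (Injective)

record Graph (n : ℕ) : Set where
  field
    adj   : Fin n → Fin n → Bool
    sym   : ∀ i j → adj i j ≡ adj j i
    irref : ∀ i → adj i i ≡ false
open Graph public

starAdj : {m : ℕ} → Fin (suc m) → Fin (suc m) → Bool
starAdj zero    zero    = false
starAdj zero    (suc _) = true
starAdj (suc _) zero    = true
starAdj (suc _) (suc _) = false

starSym : {m : ℕ} (i j : Fin (suc m)) → starAdj i j ≡ starAdj j i
starSym zero    zero    = refl
starSym zero    (suc _) = refl
starSym (suc _) zero    = refl
starSym (suc _) (suc _) = refl

starIrr : {m : ℕ} (i : Fin (suc m)) → starAdj i i ≡ false
starIrr zero    = refl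
starIrr (suc _) = refl

K1 : (m : ℕ) → Graph (suc m)
K1 m = record { adj = starAdj ; sym = starSym ; irref = starIrr }

-- A red/blue edge colouring of F: a symmetric colour assignment to pairs
-- (true = red, false = blue); only values on edges of F matter.
Colouring : {v : ℕ} → Graph v → Set
Colouring {v} F = Σ (Fin v → Fin v → Bool) λ c → ∀ i j → c i j ≡ c j i

InducedEmbedding : {h v : ℕ} → Graph h → Graph v → (Fin h → Fin v) → Set
InducedEmbedding H F f =
  Injective _≡_ _≡_ f × (∀ i j → adj F (f i) (f j) ≡ adj H i j)

MonoInducedCopy : {h v : ℕ} → Graph h → (F : Graph v) →
                  (Fin v → Fin v → Bool) → Bool → Set
MonoInducedCopy {h} {v} H F c b =
  Σ (Fin h → Fin v) λ f → InducedEmbedding H F f ×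
    (∀ i j → adj H i j ≡ true → c (f i) (f j) ≡ b)

Arrows : {v h g : ℕ} → Graph v → Graph h → Graph g → Set
Arrows F H G = ∀ (C : Colouring F) →
  let c = Data.Product.proj₁ C in
  MonoInducedCopy H F c true ⊎ MonoInducedCopy G F c false

IsIR : {h g : ℕ} → Graph h → Graph g → ℕ → Set
IsIR H G k =
  (Σ (Graph k) λ F → Arrows F H G) ×
  (∀ m → m < k → (F : Graph m) → ¬ Arrows F H G)

-- Upper bound: in any colouring of the star K_{1,n+ℓ+1} the centre sees ℓ+1 red or n+1 blue
-- edges, and every set of leaves spans an induced substar.
-- Lower bound: a graph on at most n+ℓ+1 vertices is coloured by induction on its order. If some
-- vertex v has degree at most n, colour its edges blue: v is not the centre of a blue K_{1,n+1},
-- so such a star still contains a blue induced K_{1,n} of G - v, excluded by the case (ℓ, n-1).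
-- Otherwise colour the edges at any vertex red and pass to (ℓ-1, n): now there is no induced
-- K_{1,ℓ+1} at all, since a leaf would have more than n neighbours and at least ℓ+1
-- non-neighbours (the leaves, itself included).
module Submission where

open import Defs renaming (sym to adj-sym)
open import Data.Nat using (ℕ; zero; suc; _+_; _≤_; _≤?_; z≤n; s≤s)
open import Data.Nat.Properties
  using (+-suc; +-comm; ≤-trans; ≤-reflexive; ≤-pred; ≰⇒>; 1+n≰n;
         +-monoˡ-≤; +-monoʳ-≤; +-cancelˡ-≤; module ≤-Reasoning)
open import Data.Fin using (Fin; punchIn; punchOut; lift) renaming (zero to fzero; suc to fsuc)
open import Data.Fin.Properties
  using (_≟_; any?; ¬Fin0; suc-injective; injective⇒≤; punchIn-injective; punchInᵢ≢i;
         punchOut-injective; punchOut-cong; lift-injective; punchOut-punchIn; punchIn-punchOut)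
open import Data.Bool using (Bool; true; false; not; if_then_else_)
open import Data.Bool.Properties using (not-¬; not-injective)
open import Data.Product using (Σ; _×_; _,_; proj₁; proj₂)
open import Data.Sum using (_⊎_; inj₁; inj₂; [_,_])
open import Data.Empty using (⊥-elim)
open import Function using (_∘_)
open import Function.Definitions using (Injective)
open import Relation.Binary.PropositionalEquality
  using (_≡_; _≢_; refl; sym; trans; cong; cong₂; subst; subst₂)
open import Relation.Nullary using (¬_; yes; no)

private
  variable
    m k : ℕ

pigeonhole-+ : ∀ {a b x y} → b + suc a ≤ x + y → suc a ≤ x ⊎ suc b ≤ y
pigeonhole-+ {a} {b} {x} {y} b+1+a≤x+y with suc a ≤? x
... | yes 1+a≤x = inj₁ 1+a≤x
... | no  1+a≰x = inj₂ (+-cancelˡ-≤ a _ _ (begin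
  a + suc b  ≡⟨ trans (+-comm a (suc b)) (sym (+-suc b a)) ⟩
  b + suc a  ≤⟨ b+1+a≤x+y ⟩
  x + y      ≤⟨ +-monoˡ-≤ y (≤-pred (≰⇒> 1+a≰x)) ⟩
  a + y      ∎))
  where open ≤-Reasoning

count : (Fin m → Bool) → ℕ
count {zero}  p = 0
count {suc m} p = (if p fzero then 1 else 0) + count (p ∘ fsuc)

count-true+count-false : (p : Fin m → Bool) → count p + count (not ∘ p) ≡ m
count-true+count-false {zero}  p = refl
count-true+count-false {suc m} p with p fzero
... | true  = cong suc (count-true+count-false (p ∘ fsuc))
... | false = trans (+-suc _ _) (cong suc (count-true+count-false (p ∘ fsuc)))

count-punchIn : (p : Fin (suc m) → Bool) (v : Fin (suc m)) → p v ≡ true →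
                count p ≡ suc (count (p ∘ punchIn v))
count-punchIn p fzero pv rewrite pv = refl
count-punchIn {suc m} p (fsuc v) pv with p fzero
... | true  = cong suc (count-punchIn (p ∘ fsuc) v pv)
... | false = count-punchIn (p ∘ fsuc) v pv

punchOutᶠ : {v : Fin (suc m)} {f : Fin k → Fin (suc m)} → (∀ i → v ≢ f i) → Fin k → Fin m
punchOutᶠ v∉f i = punchOut (v∉f i)

punchOutᶠ-injective : {v : Fin (suc m)} {f : Fin k → Fin (suc m)} → Injective _≡_ _≡_ f →
                      (v∉f : ∀ i → v ≢ f i) → Injective _≡_ _≡_ (punchOutᶠ v∉f)
punchOutᶠ-injective f-inj v∉f e = f-inj (punchOut-injective (v∉f _) (v∉f _) e)

injection⇒≤count : (p : Fin m → Bool) {f : Fin k → Fin m} →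
                   Injective _≡_ _≡_ f → (∀ i → p (f i) ≡ true) → k ≤ count p
injection⇒≤count {k = zero}          p _ _ = z≤n
injection⇒≤count {zero}  {suc k} p {f} _ _ = ⊥-elim (¬Fin0 (f fzero))
injection⇒≤count {suc m} {suc k} p {f} f-inj f-sat =
  subst (suc k ≤_) (sym (count-punchIn p v (f-sat fzero)))
    (s≤s (injection⇒≤count (p ∘ punchIn v) (punchOutᶠ-injective (suc-injective ∘ f-inj) v∉rest)
      (λ i → subst (λ u → p u ≡ true) (sym (punchIn-punchOut (v∉rest i))) (f-sat (fsuc i)))))
  where
  v = f fzero
  v∉rest : ∀ i → v ≢ f (fsuc i)
  v∉rest i e with () ← f-inj e

≤count⇒injection : (p : Fin m → Bool) → k ≤ count p →
                   Σ (Fin k → Fin m) λ f → Injective _≡_ _≡_ f × (∀ i → p (f i) ≡ true)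
≤count⇒injection {k = zero}      p _ = (λ ()) , (λ {i} → ⊥-elim (¬Fin0 i)) , λ ()
≤count⇒injection {zero} {suc k} p ()
≤count⇒injection {suc m} {suc k} p k<count with p fzero in p₀
≤count⇒injection {suc m} {suc k} p (s≤s k≤count) | true
  with f , f-inj , f-sat ← ≤count⇒injection (p ∘ fsuc) k≤count
  = lift 1 f , lift-injective f f-inj 1 , λ { fzero → p₀ ; (fsuc i) → f-sat i }
... | false with f , f-inj , f-sat ← ≤count⇒injection (p ∘ fsuc) k<count
  = fsuc ∘ f , f-inj ∘ suc-injective , f-sat

avoidingSubfamily : {f : Fin (suc k) → Fin m} → Injective _≡_ _≡_ f → (v : Fin m) →
                    Σ (Fin k → Fin (suc k)) λ h → Injective _≡_ _≡_ h × (∀ i → v ≢ f (h i))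
avoidingSubfamily {f = f} f-inj v with any? (λ i → f i ≟ v)
... | yes (i₀ , fi₀≡v) = punchIn i₀ , punchIn-injective i₀ _ _ ,
                         λ i v≡f → punchInᵢ≢i i₀ i (f-inj (trans (sym v≡f) (sym fi₀≡v)))
... | no  v∉f          = fsuc , suc-injective , λ i v≡f → v∉f (fsuc i , sym v≡f)

degree : Graph m → Fin m → ℕ
degree G v = count (adj G v)

record Star (G : Graph m) (c : Fin m → Fin m → Bool) (b : Bool) (k : ℕ) : Set where
  field
    centre         : Fin m
    leaf           : Fin k → Fin m
    leaf-injective : Injective _≡_ _≡_ leaf
    centre-adj     : ∀ i → adj G centre (leaf i) ≡ true
    leaves-nonadj  : ∀ i j → adj G (leaf i) (leaf j) ≡ false
    colour         : ∀ i → c centre (leaf i) ≡ b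

  vertex : Fin (suc k) → Fin m
  vertex fzero    = centre
  vertex (fsuc i) = leaf i

  centre≢leaf : ∀ i → centre ≢ leaf i
  centre≢leaf i e = not-¬ refl (trans (sym (centre-adj i))
                                      (trans (cong (λ u → adj G u (leaf i)) e) (irref G (leaf i))))

  vertex-injective : Injective _≡_ _≡_ vertex
  vertex-injective {fzero}  {fzero}  _ = refl
  vertex-injective {fzero}  {fsuc j} e = ⊥-elim (centre≢leaf j e)
  vertex-injective {fsuc i} {fzero}  e = ⊥-elim (centre≢leaf i (sym e))
  vertex-injective {fsuc i} {fsuc j} e = cong fsuc (leaf-injective e)

open Star

module _ {G : Graph m} {c : Fin m → Fin m → Bool} {b : Bool} where

  MonoInducedCopy⇒Star : MonoInducedCopy (K1 k) G c b → Star G c b k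
  MonoInducedCopy⇒Star (f , (f-inj , f-adj) , f-colour) = record
    { centre         = f fzero
    ; leaf           = f ∘ fsuc
    ; leaf-injective = suc-injective ∘ f-inj
    ; centre-adj     = λ i → f-adj fzero (fsuc i)
    ; leaves-nonadj  = λ i j → f-adj (fsuc i) (fsuc j)
    ; colour         = λ i → f-colour fzero (fsuc i) refl
    }

  Star⇒MonoInducedCopy : (∀ i j → c i j ≡ c j i) → Star G c b k → MonoInducedCopy (K1 k) G c b
  Star⇒MonoInducedCopy c-sym S = vertex S , (vertex-injective S , adjacency) , colouring
    where
    adjacency : ∀ i j → adj G (vertex S i) (vertex S j) ≡ adj (K1 _) i j
    adjacency fzero    fzero    = irref G (centre S)
    adjacency fzero    (fsuc j) = centre-adj S j
    adjacency (fsuc i) fzero    = trans (adj-sym G _ _) (centre-adj S i)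
    adjacency (fsuc i) (fsuc j) = leaves-nonadj S i j
    colouring : ∀ i j → adj (K1 _) i j ≡ true → c (vertex S i) (vertex S j) ≡ b
    colouring fzero    (fsuc j) _ = colour S j
    colouring (fsuc i) fzero    _ = trans (c-sym _ _) (colour S i)

  Star⇒size : Star G c b k → suc k ≤ m
  Star⇒size S = injective⇒≤ (vertex-injective S)

  Star⇒≤degree : (S : Star G c b k) → k ≤ degree G (centre S)
  Star⇒≤degree S = injection⇒≤count _ (leaf-injective S) (centre-adj S)

  Star⇒leaf-degree : (S : Star G c b k) (i : Fin k) → degree G (leaf S i) + k ≤ m
  Star⇒leaf-degree S i = subst (degree G u + _ ≤_) (count-true+count-false (adj G u))
    (+-monoʳ-≤ (degree G u)
      (injection⇒≤count (not ∘ adj G u) (leaf-injective S) (cong not ∘ leaves-nonadj S i)))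
    where u = leaf S i

  reindexLeaves : {k′ : ℕ} {h : Fin k → Fin k′} → Injective _≡_ _≡_ h → Star G c b k′ → Star G c b k
  reindexLeaves {h = h} h-inj S = record
    { centre         = centre S
    ; leaf           = leaf S ∘ h
    ; leaf-injective = h-inj ∘ leaf-injective S
    ; centre-adj     = centre-adj S ∘ h
    ; leaves-nonadj  = λ i j → leaves-nonadj S (h i) (h j)
    ; colour         = colour S ∘ h
    }

_─_ : Graph (suc m) → Fin (suc m) → Graph m
G ─ v = record
  { adj   = λ i j → adj G (punchIn v i) (punchIn v j)
  ; sym   = λ i j → adj-sym G (punchIn v i) (punchIn v j)
  ; irref = irref G ∘ punchIn v
  }

extend : Fin (suc m) → Bool → (Fin m → Fin m → Bool) → Fin (suc m) → Fin (suc m) → Bool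
extend v b c x y with v ≟ x | v ≟ y
... | no v≢x | no v≢y = c (punchOut v≢x) (punchOut v≢y)
... | _      | _      = b

module _ (v : Fin (suc m)) (b : Bool) {c : Fin m → Fin m → Bool} where

  extend-sym : (∀ i j → c i j ≡ c j i) → ∀ x y → extend v b c x y ≡ extend v b c y x
  extend-sym c-sym x y with v ≟ x | v ≟ y
  ... | yes _ | yes _ = refl
  ... | yes _ | no  _ = refl
  ... | no  _ | yes _ = refl
  ... | no  _ | no  _ = c-sym _ _

  extend-at : ∀ y → extend v b c v y ≡ b
  extend-at y with v ≟ v
  ... | yes _   = refl
  ... | no  v≢v = ⊥-elim (v≢v refl)

  extend-punchIn : ∀ i j → extend v b c (punchIn v i) (punchIn v j) ≡ c i j
  extend-punchIn i j with v ≟ punchIn v i | v ≟ punchIn v j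
  ... | yes v≡i | _       = ⊥-elim (punchInᵢ≢i v i (sym v≡i))
  ... | no  _   | yes v≡j = ⊥-elim (punchInᵢ≢i v j (sym v≡j))
  ... | no  v≢i | no  v≢j = cong₂ c (punchOut-punchIn′ v≢i) (punchOut-punchIn′ v≢j)
    where
    punchOut-punchIn′ : ∀ {i} (v≢i : v ≢ punchIn v i) → punchOut v≢i ≡ i
    punchOut-punchIn′ v≢i = trans (punchOut-cong v refl) (punchOut-punchIn v)

module _ {G : Graph (suc m)} (v : Fin (suc m)) {b : Bool} {c : Fin m → Fin m → Bool} where

  restrictStar : {b′ : Bool} (S : Star G (extend v b c) b′ k) → v ≢ centre S → (∀ i → v ≢ leaf S i) →
                 Star (G ─ v) c b′ k
  restrictStar {b′ = b′} S v≢centre v∉leaves = record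
    { centre         = punchOut v≢centre
    ; leaf           = punchOutᶠ v∉leaves
    ; leaf-injective = punchOutᶠ-injective (leaf-injective S) v∉leaves
    ; centre-adj     = λ i → transport (λ x y → adj G x y ≡ true) (centre-adj S i)
    ; leaves-nonadj  = λ i j → transport (λ x y → adj G x y ≡ false) (leaves-nonadj S i j)
    ; colour         = λ i → trans (sym (extend-punchIn v b _ _))
                               (transport (λ x y → extend v b c x y ≡ b′) (colour S i))
    }
    where
    transport : ∀ {x y} {v≢x : v ≢ x} {v≢y : v ≢ y} (R : Fin (suc m) → Fin (suc m) → Set) →
                R x y → R (punchIn v (punchOut v≢x)) (punchIn v (punchOut v≢y))
    transport {v≢x = v≢x} {v≢y} R = subst₂ R (sym (punchIn-punchOut v≢x)) (sym (punchIn-punchOut v≢y))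

  extend-¬Star-opposite : (∀ i j → c i j ≡ c j i) → ¬ Star (G ─ v) c (not b) (suc k) →
                          ¬ Star G (extend v b c) (not b) (suc k)
  extend-¬Star-opposite c-sym ¬S S = ¬S (restrictStar S
    (λ v≡centre → not-coloured v≡centre (colour S fzero))
    (λ i v≡leaf → not-coloured v≡leaf (trans (extend-sym v b c-sym _ _) (colour S i))))
    where
    not-coloured : ∀ {x y} → v ≡ x → extend v b c x y ≢ not b
    not-coloured {y = y} v≡x e = not-¬ refl (trans (sym (extend-at v b y))
                                   (subst (λ u → extend v b c u y ≡ not b) (sym v≡x) e))

  extend-¬Star-same : ¬ Star (G ─ v) c b k → ((S : Star G (extend v b c) b (suc k)) → v ≢ centre S) →
                      ¬ Star G (extend v b c) b (suc k)
  extend-¬Star-same ¬S v≢centre S with h , h-inj , v∉leaves ← avoidingSubfamily (leaf-injective S) v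
    = ¬S (restrictStar (reindexLeaves h-inj S) (v≢centre S) v∉leaves)

record AvoidingColouring (G : Graph m) (r s : ℕ) : Set where
  field
    colouring : Colouring G
    ¬redStar  : ¬ Star G (proj₁ colouring) true r
    ¬blueStar : ¬ Star G (proj₁ colouring) false s
open AvoidingColouring

AvoidingColouring⇒¬Arrows : ∀ {r s} {G : Graph m} → AvoidingColouring G r s → ¬ Arrows G (K1 r) (K1 s)
AvoidingColouring⇒¬Arrows A arrows =
  [ ¬redStar A ∘ MonoInducedCopy⇒Star , ¬blueStar A ∘ MonoInducedCopy⇒Star ] (arrows (colouring A))

monochromatic : (G : Graph m) → Bool → Colouring G
monochromatic G b = (λ _ _ → b) , λ _ _ → refl

module _ {G : Graph m} where

  ¬Star-too-big : ∀ {c b} → m ≤ k → ¬ Star G c b k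
  ¬Star-too-big m≤k S = 1+n≰n (≤-trans (Star⇒size S) m≤k)

  ¬Star-other-colour : ∀ {b} → ¬ Star G (λ _ _ → not b) b (suc k)
  ¬Star-other-colour S = not-¬ refl (sym (colour S fzero))

avoidingColouring : ∀ m l n → m ≤ l + suc n → (G : Graph m) → AvoidingColouring G (suc l) (suc n)
avoidingColouring m zero n m≤ G = record
  { colouring = monochromatic G false ; ¬redStar = ¬Star-other-colour ; ¬blueStar = ¬Star-too-big m≤ }
avoidingColouring m (suc l) zero m≤ G = record
  { colouring = monochromatic G true
  ; ¬redStar  = ¬Star-too-big (subst (m ≤_) (+-comm (suc l) 1) m≤)
  ; ¬blueStar = ¬Star-other-colour
  }
avoidingColouring zero (suc l) (suc n) _ G = record
  { colouring = monochromatic G false ; ¬redStar = ¬Star-other-colour ; ¬blueStar = ¬Star-too-big z≤n }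
avoidingColouring (suc m) (suc l) (suc n) (s≤s m≤) G with any? (λ v → degree G v ≤? suc n)
... | yes (v , deg≤) = record
  { colouring = extend v false c , extend-sym v false c-sym
  ; ¬redStar  = extend-¬Star-opposite v c-sym (¬redStar A)
  ; ¬blueStar = extend-¬Star-same v (¬blueStar A)
      (λ S v≡centre → 1+n≰n (≤-trans (Star⇒≤degree S) (subst (λ u → degree G u ≤ suc n) v≡centre deg≤)))
  }
  where
  A = avoidingColouring m (suc l) n (subst (m ≤_) (+-suc l (suc n)) m≤) (G ─ v)
  c = proj₁ (colouring A)
  c-sym = proj₂ (colouring A)
... | no ∄low = record
  { colouring = extend fzero true c , extend-sym fzero true c-sym
  ; ¬redStar  = extend-¬Star-same fzero (¬redStar A) (λ S _ → ⊥-elim (¬Star-high-degree S))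
  ; ¬blueStar = extend-¬Star-opposite fzero c-sym (¬blueStar A)
  }
  where
  A = avoidingColouring m l (suc n) m≤ (G ─ fzero)
  c = proj₁ (colouring A)
  c-sym = proj₂ (colouring A)
  ¬Star-high-degree : ∀ {c′ b} → ¬ Star G c′ b (suc (suc l))
  ¬Star-high-degree S = 1+n≰n (begin
    suc (suc (suc n) + suc l)  ≡⟨ sym (+-suc (suc (suc n)) (suc l)) ⟩
    suc (suc n) + suc (suc l)  ≤⟨ +-monoˡ-≤ _ (≰⇒> (∄low ∘ (u ,_))) ⟩
    degree G u + suc (suc l)   ≤⟨ Star⇒leaf-degree S fzero ⟩
    suc m                      ≤⟨ s≤s m≤ ⟩
    suc (l + suc (suc n))      ≡⟨ cong suc (+-comm l (suc (suc n))) ⟩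
    suc (suc (suc n) + l)      ≡⟨ sym (+-suc (suc (suc n)) l) ⟩
    suc (suc n) + suc l        ∎)
    where
    open ≤-Reasoning
    u = leaf S fzero

centreStar : ∀ {q b} {c : Fin (suc q) → Fin (suc q) → Bool} {g : Fin k → Fin q} →
             Injective _≡_ _≡_ g → (∀ i → c fzero (fsuc (g i)) ≡ b) → Star (K1 q) c b k
centreStar {g = g} g-inj g-colour = record
  { centre         = fzero
  ; leaf           = fsuc ∘ g
  ; leaf-injective = g-inj ∘ suc-injective
  ; centre-adj     = λ _ → refl
  ; leaves-nonadj  = λ _ _ → refl
  ; colour         = g-colour
  }

star-arrows : ∀ ℓ n → Arrows (K1 (n + suc ℓ)) (K1 (suc ℓ)) (K1 (suc n))
star-arrows ℓ n (c , c-sym)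
  with pigeonhole-+ {ℓ} {n} (≤-reflexive (sym (count-true+count-false (λ i → c fzero (fsuc i)))))
... | inj₁ ℓ<red  with _ , g-inj , g-red  ← ≤count⇒injection _ ℓ<red
  = inj₁ (Star⇒MonoInducedCopy c-sym (centreStar g-inj g-red))
... | inj₂ n<blue with _ , g-inj , g-blue ← ≤count⇒injection _ n<blue
  = inj₂ (Star⇒MonoInducedCopy c-sym (centreStar g-inj (not-injective ∘ g-blue)))

lemma1 : (ℓ n : ℕ) → IsIR (K1 (suc ℓ)) (K1 (suc n)) (suc n + suc ℓ)
lemma1 ℓ n = (K1 (n + suc ℓ) , star-arrows ℓ n) , λ m m<n+ℓ+2 F →
  AvoidingColouring⇒¬Arrows (avoidingColouring m ℓ n (subst (m ≤_) n+1+ℓ≡ℓ+1+n (≤-pred m<n+ℓ+2)) F)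
  where
  n+1+ℓ≡ℓ+1+n : n + suc ℓ ≡ ℓ + suc n
  n+1+ℓ≡ℓ+1+n = trans (+-suc n ℓ) (trans (cong suc (+-comm n ℓ)) (sym (+-suc ℓ n)))
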